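{- Let $m$ be an odd multiple of $3$. Then the rose window graph $R_{2m}(m-2,m-1)$ is a Cayley graph.
   Context: For integers $n\ge 3$ and $1\le a,r\le n-1$, the rose window graph $R_n(a,r)$ has vertex set $\{A_i,B_i : i\in\mathbb{Z}_n\}$ and edges $A_iA_{i+1}$, $A_iB_i$, $A_{i+a}B_i$ and $B_iB_{i+r}$, indices taken modulo $n$. A graph is Cayley iff its automorphism group has a subgroup acting regularly on its vertices. -}

module Defs where

open import Data.Nat using (ℕ; zero; suc; _+_; _%_)
open import Data.Nat.DivMod using (m%n<n)
open import Data.Fin using (Fin; toℕ; fromℕ<)
open import Data.Product using (Σ; _×_; _,_; ∃)
open import Data.Sum using (_⊎_)
open import Relation.Binary.PropositionalEquality using (_≡_)
open import Level using (0ℓ) renaming (suc to lsuc)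

record Graph : Set₁ where
  field
    V   : Set
    Adj : V → V → Set

_⊕_ : ∀ {n} → Fin n → ℕ → Fin n
_⊕_ {suc n} i k = fromℕ< (m%n<n (toℕ i + k) (suc n))

data RVertex (n : ℕ) : Set where
  A : Fin n → RVertex n
  B : Fin n → RVertex n

data REdge (n a r : ℕ) : RVertex n → RVertex n → Set where
  rim   : ∀ i → REdge n a r (A i) (A (i ⊕ 1))
  spoke : ∀ i → REdge n a r (A i) (B i)
  spoke' : ∀ i → REdge n a r (A (i ⊕ a)) (B i)
  hub   : ∀ i → REdge n a r (B i) (B (i ⊕ r))

Rose : ℕ → ℕ → ℕ → Graph
Rose n a r = record
  { V   = RVertex n
  ; Adj = λ x y → REdge n a r x y ⊎ REdge n a r y x }

record Aut (Γ : Graph) : Set where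
  open Graph Γ
  field
    fun     : V → V
    inv     : V → V
    invˡ    : ∀ x → inv (fun x) ≡ x
    invʳ    : ∀ x → fun (inv x) ≡ x
    adj→    : ∀ x y → Adj x y → Adj (fun x) (fun y)
    adj←    : ∀ x y → Adj (fun x) (fun y) → Adj x y

module _ {Γ : Graph} where
  open Graph Γ
  open Aut

  _≐_ : Aut Γ → Aut Γ → Set
  f ≐ g = ∀ x → fun f x ≡ fun g x

  idAut : Aut Γ
  idAut = record
    { fun = λ x → x ; inv = λ x → x
    ; invˡ = λ _ → Relation.Binary.PropositionalEquality.refl
    ; invʳ = λ _ → Relation.Binary.PropositionalEquality.refl
    ; adj→ = λ _ _ e → e ; adj← = λ _ _ e → e }

  _∘A_ : Aut Γ → Aut Γ → Aut Γ
  f ∘A g = record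
    { fun = λ x → fun f (fun g x)
    ; inv = λ x → inv g (inv f x)
    ; invˡ = λ x → Relation.Binary.PropositionalEquality.trans
               (Relation.Binary.PropositionalEquality.cong (inv g) (invˡ f (fun g x))) (invˡ g x)
    ; invʳ = λ x → Relation.Binary.PropositionalEquality.trans
               (Relation.Binary.PropositionalEquality.cong (fun f) (invʳ g (inv f x))) (invʳ f x)
    ; adj→ = λ x y e → adj→ f _ _ (adj→ g x y e)
    ; adj← = λ x y e → adj← g x y (adj← f _ _ e) }

  invAut : Aut Γ → Aut Γ
  invAut f = record
    { fun = inv f ; inv = fun f ; invˡ = invʳ f ; invʳ = invˡ f
    ; adj→ = λ x y e → adj← f _ _
        (Relation.Binary.PropositionalEquality.subst₂ Adj
          (Relation.Binary.PropositionalEquality.sym (invʳ f x))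
          (Relation.Binary.PropositionalEquality.sym (invʳ f y)) e)
    ; adj← = λ x y e → Relation.Binary.PropositionalEquality.subst₂ Adj
        (invʳ f x) (invʳ f y) (adj→ f _ _ e) }

  record IsSubgroup (H : Aut Γ → Set) : Set where
    field
      resp  : ∀ {f g} → f ≐ g → H f → H g
      hasId : H idAut
      ∘-closed : ∀ {f g} → H f → H g → H (f ∘A g)
      inv-closed : ∀ {f} → H f → H (invAut f)

  record ActsRegularly (H : Aut Γ → Set) : Set where
    field
      transitive : ∀ x y → Σ (Aut Γ) λ g → H g × fun g x ≡ y
      free       : ∀ {g h} x → H g → H h → fun g x ≡ fun h x → g ≐ h

IsCayley : Graph → Set₁
IsCayley Γ = Σ (Aut Γ → Set) λ H → IsSubgroup {Γ} H × ActsRegularly {Γ} H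

-- Write m = 3 + 6p, n = 2m, and let ρ be the rotation i ↦ i + 1 of both rings of R_n(m − 2, m − 1).
-- Besides ρ the graph has an involutory automorphism α commuting with ρ³: according to the residue
-- of i mod 3 it either moves A_i or B_i by the half turn m within its ring, or swaps it into the
-- other ring.  The conjugates β_c = ρ^{−c} α ρ^c depend only on c mod 3 and satisfy α β₁ = β₂, so
-- K = {1, β₀, β₁, β₂} is a Klein four-group normalised by ρ, and H = ⟨ρ²⟩ K has order 4m.  The
-- elements of H send A₀ to every vertex, and none but the rotations ρ^{2j} fixes a vertex, since an
-- even rotation can neither undo a swap of rings nor the odd shift m; so H acts regularly.
module Submission where

open import Defs
open import Data.Nat
open import Data.Nat.Properties using (+-assoc; +-comm; +-identityʳ; *-comm; *-distribˡ-+; <⇒≤; m+[n∸m]≡n)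
open import Data.Nat.DivMod
open import Data.Nat.Divisibility using (_∣_; divides; m%n≡0⇒n∣m; ∣-trans; ∣1⇒≡1; ∣m+n∣m⇒∣n; n∣m*n)
open import Data.Nat.Tactic.RingSolver
open import Data.Fin using (Fin; toℕ) renaming (zero to fzero; suc to fsuc)
open import Data.Fin.Properties using (toℕ-fromℕ<; toℕ-injective; toℕ<n)
open import Data.Maybe using (Maybe; just; nothing)
import Data.Maybe as Maybe
open import Data.Product using (Σ; _×_; _,_)
open import Data.Sum using (inj₁; inj₂)
open import Data.List using (_∷_; [])
open import Data.Empty using (⊥-elim)
open import Function using (_∘_)
open import Relation.Nullary using (¬_)
open import Relation.Binary.PropositionalEquality
open ≡-Reasoning

-- Index arithmetic in ℤ_n

[m%n+o]%n≡[m+o]%n : ∀ m o n .{{_ : NonZero n}} → (m % n + o) % n ≡ (m + o) % n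
[m%n+o]%n≡[m+o]%n m o n = begin
  (m % n + o) % n         ≡⟨ %-distribˡ-+ (m % n) o n ⟩
  (m % n % n + o % n) % n ≡⟨ cong (λ x → (x + o % n) % n) (m%n%n≡m%n m n) ⟩
  (m % n + o % n) % n     ≡⟨ %-distribˡ-+ m o n ⟨
  (m + o) % n             ∎

module _ {N : ℕ} where

  toℕ-⊕ : ∀ (i : Fin (suc N)) s → toℕ (i ⊕ s) ≡ (toℕ i + s) % suc N
  toℕ-⊕ i s = toℕ-fromℕ< _

  ⊕-cong : ∀ (i : Fin (suc N)) s j t → (toℕ i + s) % suc N ≡ (toℕ j + t) % suc N → i ⊕ s ≡ j ⊕ t
  ⊕-cong i s j t eq = toℕ-injective (trans (toℕ-⊕ i s) (trans eq (sym (toℕ-⊕ j t))))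

  ⊕-identityʳ : ∀ (i : Fin (suc N)) → i ⊕ 0 ≡ i
  ⊕-identityʳ i = toℕ-injective {i = i ⊕ 0} {j = i} (begin
    toℕ (i ⊕ 0)         ≡⟨ toℕ-⊕ i 0 ⟩
    (toℕ i + 0) % suc N ≡⟨ cong (_% suc N) (+-identityʳ (toℕ i)) ⟩
    toℕ i % suc N       ≡⟨ m<n⇒m%n≡m (toℕ<n i) ⟩
    toℕ i               ∎)

  ⊕-assoc : ∀ (i : Fin (suc N)) s t → (i ⊕ s) ⊕ t ≡ i ⊕ (s + t)
  ⊕-assoc i s t = ⊕-cong (i ⊕ s) t i (s + t) (begin
    (toℕ (i ⊕ s) + t) % suc N         ≡⟨ cong (λ x → (x + t) % suc N) (toℕ-⊕ i s) ⟩
    ((toℕ i + s) % suc N + t) % suc N ≡⟨ [m%n+o]%n≡[m+o]%n (toℕ i + s) t (suc N) ⟩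
    (toℕ i + s + t) % suc N           ≡⟨ cong (_% suc N) (+-assoc (toℕ i) s t) ⟩
    (toℕ i + (s + t)) % suc N         ∎)

  ⊕-comm : ∀ (i : Fin (suc N)) s t → (i ⊕ s) ⊕ t ≡ (i ⊕ t) ⊕ s
  ⊕-comm i s t = begin
    (i ⊕ s) ⊕ t ≡⟨ ⊕-assoc i s t ⟩
    i ⊕ (s + t) ≡⟨ cong (i ⊕_) (+-comm s t) ⟩
    i ⊕ (t + s) ≡⟨ ⊕-assoc i t s ⟨
    (i ⊕ t) ⊕ s ∎

  ⊕-slide : ∀ (i : Fin (suc N)) s d t → (i ⊕ (s + d)) ⊕ t ≡ i ⊕ (s + t + d)
  ⊕-slide i s d t = trans (⊕-assoc i (s + d) t) (cong (i ⊕_) (begin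
    s + d + t   ≡⟨ +-assoc s d t ⟩
    s + (d + t) ≡⟨ cong (s +_) (+-comm d t) ⟩
    s + (t + d) ≡⟨ +-assoc s t d ⟨
    s + t + d   ∎))

  ⊕-≡ : ∀ (i : Fin (suc N)) s t u v → s + u * suc N ≡ t + v * suc N → i ⊕ s ≡ i ⊕ t
  ⊕-≡ i s t u v eq = ⊕-cong i s i t (begin
    (toℕ i + s) % suc N               ≡⟨ [m+kn]%n≡m%n (toℕ i + s) u (suc N) ⟨
    (toℕ i + s + u * suc N) % suc N   ≡⟨ cong (_% suc N) (+-assoc (toℕ i) s _) ⟩
    (toℕ i + (s + u * suc N)) % suc N ≡⟨ cong (λ x → (toℕ i + x) % suc N) eq ⟩
    (toℕ i + (t + v * suc N)) % suc N ≡⟨ cong (_% suc N) (+-assoc (toℕ i) t _) ⟨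
    (toℕ i + t + v * suc N) % suc N   ≡⟨ [m+kn]%n≡m%n (toℕ i + t) v (suc N) ⟩
    (toℕ i + t) % suc N               ∎)

  ⊕-≡-⊕ : ∀ (i : Fin (suc N)) s t t' u v → s + u * suc N ≡ t + t' + v * suc N → i ⊕ s ≡ (i ⊕ t) ⊕ t'
  ⊕-≡-⊕ i s t t' u v eq = trans (⊕-≡ i s (t + t') u v eq) (sym (⊕-assoc i t t'))

  ⊕-period : ∀ (i : Fin (suc N)) s v → s ≡ v * suc N → i ⊕ s ≡ i
  ⊕-period i s v eq = trans (⊕-≡ i s 0 0 v (trans (+-identityʳ s) eq)) (⊕-identityʳ i)

  zero-⊕-toℕ : ∀ (i : Fin (suc N)) → fzero ⊕ toℕ i ≡ i
  zero-⊕-toℕ i = toℕ-injective (trans (toℕ-⊕ fzero (toℕ i)) (m<n⇒m%n≡m (toℕ<n i)))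

  zero-⊕ : ∀ (i : Fin (suc N)) s u v → s + u * suc N ≡ toℕ i + v * suc N → fzero ⊕ s ≡ i
  zero-⊕ i s u v eq = trans (⊕-≡ fzero s (toℕ i) u v eq) (zero-⊕-toℕ i)

  ⊕-reach : ∀ (i j : Fin (suc N)) → i ⊕ (suc N ∸ toℕ i + toℕ j) ≡ j
  ⊕-reach i j = toℕ-injective (begin
    toℕ (i ⊕ (suc N ∸ toℕ i + toℕ j))         ≡⟨ toℕ-⊕ i _ ⟩
    (toℕ i + (suc N ∸ toℕ i + toℕ j)) % suc N ≡⟨ cong (_% suc N) (+-assoc (toℕ i) _ (toℕ j)) ⟨
    (toℕ i + (suc N ∸ toℕ i) + toℕ j) % suc N
      ≡⟨ cong (λ x → (x + toℕ j) % suc N) (m+[n∸m]≡n (<⇒≤ (toℕ<n i))) ⟩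
    (suc N + toℕ j) % suc N                   ≡⟨ cong (_% suc N) (+-comm (suc N) (toℕ j)) ⟩
    (toℕ j + suc N) % suc N                   ≡⟨ [m+n]%n≡m%n (toℕ j) (suc N) ⟩
    toℕ j % suc N                             ≡⟨ m<n⇒m%n≡m (toℕ<n j) ⟩
    toℕ j                                     ∎)

  ⊕-fixed : ∀ {i : Fin (suc N)} {s} → i ⊕ s ≡ i → ∀ j → j ⊕ s ≡ j
  ⊕-fixed {i} {s} fix j = begin
    j ⊕ s       ≡⟨ cong (_⊕ s) (⊕-reach i j) ⟨
    (i ⊕ u) ⊕ s ≡⟨ ⊕-comm i u s ⟩
    (i ⊕ s) ⊕ u ≡⟨ cong (_⊕ u) fix ⟩
    i ⊕ u       ≡⟨ ⊕-reach i j ⟩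
    j           ∎
    where
    u = suc N ∸ toℕ i + toℕ j

  ⊕-fixed⇒∣ : ∀ {i : Fin (suc N)} {s} → i ⊕ s ≡ i → suc N ∣ s
  ⊕-fixed⇒∣ {s = s} fix =
    m%n≡0⇒n∣m s (suc N) (trans (sym (toℕ-⊕ fzero s)) (cong toℕ (⊕-fixed fix fzero)))

-- Rotations of a rose window graph

module _ {N : ℕ} where

  rotate : ℕ → RVertex (suc N) → RVertex (suc N)
  rotate t (A i) = A (i ⊕ t)
  rotate t (B i) = B (i ⊕ t)

  rotate⁻¹ : ℕ → RVertex (suc N) → RVertex (suc N)
  rotate⁻¹ t = rotate (t * N)

  index : RVertex (suc N) → Fin (suc N)
  index (A i) = i
  index (B i) = i

  rotate-rotate : ∀ s t x → rotate t (rotate s x) ≡ rotate (s + t) x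
  rotate-rotate s t (A i) = cong A (⊕-assoc i s t)
  rotate-rotate s t (B i) = cong B (⊕-assoc i s t)

  rotate-≡ : ∀ x s t u v → s + u * suc N ≡ t + v * suc N → rotate s x ≡ rotate t x
  rotate-≡ (A i) s t u v eq = cong A (⊕-≡ i s t u v eq)
  rotate-≡ (B i) s t u v eq = cong B (⊕-≡ i s t u v eq)

  rotate-zero : ∀ x → rotate 0 x ≡ x
  rotate-zero (A i) = cong A (⊕-identityʳ i)
  rotate-zero (B i) = cong B (⊕-identityʳ i)

  rotate-period : ∀ x s v → s ≡ v * suc N → rotate s x ≡ x
  rotate-period (A i) s v eq = cong A (⊕-period i s v eq)
  rotate-period (B i) s v eq = cong B (⊕-period i s v eq)

  rotate⁻¹-rotate : ∀ t x → rotate⁻¹ t (rotate t x) ≡ x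
  rotate⁻¹-rotate t x = trans (rotate-rotate t (t * N) x) (rotate-period x (t + t * N) t (solve (t ∷ N ∷ [])))

  rotate-rotate⁻¹ : ∀ t x → rotate t (rotate⁻¹ t x) ≡ x
  rotate-rotate⁻¹ t x = trans (rotate-rotate (t * N) t x) (rotate-period x (t * N + t) t (solve (t ∷ N ∷ [])))

  rotate-fixed⇒∣ : ∀ {t} x → rotate t x ≡ x → suc N ∣ t
  rotate-fixed⇒∣ (A i) fix = ⊕-fixed⇒∣ (cong index fix)
  rotate-fixed⇒∣ (B i) fix = ⊕-fixed⇒∣ (cong index fix)

  rotate-multiple : ∀ {t} → suc N ∣ t → ∀ x → rotate t x ≡ x
  rotate-multiple (divides k eq) x = rotate-period x _ k eq

module RoseAdjacency (N a r : ℕ) where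

  open Graph (Rose (suc N) a r) using (Adj)

  Adj-sym : ∀ {x y} → Adj x y → Adj y x
  Adj-sym (inj₁ e) = inj₂ e
  Adj-sym (inj₂ e) = inj₁ e

  Adj-≡ : ∀ {x x' y y'} → x ≡ x' → y ≡ y' → Adj x' y' → Adj x y
  Adj-≡ refl refl e = e

  rotate-edge : ∀ t {x y} → REdge (suc N) a r x y → Adj (rotate t x) (rotate t y)
  rotate-edge t (rim i)    = inj₁ (subst (REdge _ a r (A (i ⊕ t)) ∘ A) (⊕-comm i t 1) (rim (i ⊕ t)))
  rotate-edge t (spoke i)  = inj₁ (spoke (i ⊕ t))
  rotate-edge t (spoke' i) = inj₁ (subst (λ j → REdge _ a r (A j) (B (i ⊕ t))) (⊕-comm i t a) (spoke' (i ⊕ t)))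
  rotate-edge t (hub i)    = inj₁ (subst (REdge _ a r (B (i ⊕ t)) ∘ B) (⊕-comm i t r) (hub (i ⊕ t)))

  rotate-adj : ∀ t {x y} → Adj x y → Adj (rotate t x) (rotate t y)
  rotate-adj t (inj₁ e) = rotate-edge t e
  rotate-adj t (inj₂ e) = Adj-sym (rotate-edge t e)

  rotation : ℕ → Aut (Rose (suc N) a r)
  rotation t = record
    { fun  = rotate t
    ; inv  = rotate⁻¹ t
    ; invˡ = rotate⁻¹-rotate t
    ; invʳ = rotate-rotate⁻¹ t
    ; adj→ = λ _ _ → rotate-adj t
    ; adj← = λ x y e → subst₂ Adj (rotate⁻¹-rotate t x) (rotate⁻¹-rotate t y) (rotate-adj (t * N) e)
    }

  rim-≈ : ∀ (i : Fin (suc N)) s t u v → s + 1 + u * suc N ≡ t + v * suc N → Adj (A (i ⊕ s)) (A (i ⊕ t))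
  rim-≈ i s t u v eq =
    inj₁ (subst (REdge _ a r (A (i ⊕ s)) ∘ A) (trans (⊕-assoc i s 1) (⊕-≡ i _ t u v eq)) (rim (i ⊕ s)))

  spoke-≈ : ∀ (i : Fin (suc N)) s t u v → s + u * suc N ≡ t + v * suc N → Adj (A (i ⊕ s)) (B (i ⊕ t))
  spoke-≈ i s t u v eq =
    inj₁ (subst (λ j → REdge _ a r (A j) (B (i ⊕ t))) (⊕-≡ i t s v u (sym eq)) (spoke (i ⊕ t)))

  spoke'-≈ : ∀ (i : Fin (suc N)) s t u v → s + u * suc N ≡ t + a + v * suc N → Adj (A (i ⊕ s)) (B (i ⊕ t))
  spoke'-≈ i s t u v eq =
    inj₁ (subst (λ j → REdge _ a r (A j) (B (i ⊕ t)))
                (trans (⊕-assoc i t a) (⊕-≡ i _ s v u (sym eq))) (spoke' (i ⊕ t)))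

  hub-≈ : ∀ (i : Fin (suc N)) s t u v → s + r + u * suc N ≡ t + v * suc N → Adj (B (i ⊕ s)) (B (i ⊕ t))
  hub-≈ i s t u v eq =
    inj₁ (subst (REdge _ a r (B (i ⊕ s)) ∘ B) (trans (⊕-assoc i s r) (⊕-≡ i _ t u v eq)) (hub (i ⊕ s)))

-- The graph R_{2m}(m − 2, m − 1) for m = 3 + 6p; its offsets appear written out in p:
-- 1 + 6p = m − 2, 2 + 6p = m − 1, 3 + 6p = m, and 5 + 12p ≡ −1 (mod 2m).

module Rose₂ₘ (p : ℕ) where

  V : Set
  V = RVertex (6 + 12 * p)

  Γ : Graph
  Γ = Rose (6 + 12 * p) (1 + 6 * p) (2 + 6 * p)

  open Graph Γ using (Adj)
  open RoseAdjacency (5 + 12 * p) (1 + 6 * p) (2 + 6 * p)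

  cls : Fin (6 + 12 * p) → ℕ
  cls i = toℕ i % 3

  -- A record rather than cls (i ⊕ s) ≡ c, so that unification can infer i, s and c.
  record Class (i : Fin (6 + 12 * p)) (s c : ℕ) : Set where
    constructor class
    field cls-≡ : cls (i ⊕ s) ≡ c
  open Class

  Class-base : ∀ i → Class i 0 (cls i)
  Class-base i = class (cong cls (⊕-identityʳ i))

  data Residue (i : Fin (6 + 12 * p)) : Set where
    res₀ : Class i 0 0 → Residue i
    res₁ : Class i 0 1 → Residue i
    res₂ : Class i 0 2 → Residue i

  residue : ∀ i → Residue i
  residue i with cls i in e | m%n<n (toℕ i) 3
  ... | 0 | _ = res₀ (subst (Class i 0) e (Class-base i))
  ... | 1 | _ = res₁ (subst (Class i 0) e (Class-base i))
  ... | 2 | _ = res₂ (subst (Class i 0) e (Class-base i))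
  ... | suc (suc (suc _)) | s≤s (s≤s (s≤s ()))

  3∣n : 3 ∣ 6 + 12 * p
  3∣n = divides (2 + 4 * p) (solve (p ∷ []))

  cls-⊕ : ∀ {i s c} d δ w → d ≡ δ + w * 3 → Class i s c → Class i (s + d) ((c + δ) % 3)
  cls-⊕ {i} {s} {c} d δ w d≡ (class e) = class (begin
    toℕ (i ⊕ (s + d)) % 3                ≡⟨ cong (λ j → toℕ j % 3) (⊕-assoc i s d) ⟨
    toℕ ((i ⊕ s) ⊕ d) % 3                ≡⟨ cong (_% 3) (toℕ-⊕ (i ⊕ s) d) ⟩
    (toℕ (i ⊕ s) + d) % (6 + 12 * p) % 3 ≡⟨ m∣n⇒o%n%m≡o%m 3 (6 + 12 * p) (toℕ (i ⊕ s) + d) 3∣n ⟩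
    (toℕ (i ⊕ s) + d) % 3                ≡⟨ cong (λ x → (toℕ (i ⊕ s) + x) % 3) d≡ ⟩
    (toℕ (i ⊕ s) + (δ + w * 3)) % 3      ≡⟨ cong (_% 3) (+-assoc (toℕ (i ⊕ s)) δ (w * 3)) ⟨
    (toℕ (i ⊕ s) + δ + w * 3) % 3        ≡⟨ [m+kn]%n≡m%n (toℕ (i ⊕ s) + δ) w 3 ⟩
    (toℕ (i ⊕ s) + δ) % 3                ≡⟨ [m%n+o]%n≡[m+o]%n (toℕ (i ⊕ s)) δ 3 ⟨
    (cls (i ⊕ s) + δ) % 3                ≡⟨ cong (λ x → (x + δ) % 3) e ⟩
    (c + δ) % 3                          ∎)

  cls-+1 : ∀ {i s c} → Class i s c → Class i (s + 1) ((c + 1) % 3)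
  cls-+1 = cls-⊕ 1 1 0 refl

  cls-+2 : ∀ {i s c} → Class i s c → Class i (s + 2) ((c + 2) % 3)
  cls-+2 = cls-⊕ 2 2 0 refl

  cls-+m−2 : ∀ {i s c} → Class i s c → Class i (s + (1 + 6 * p)) ((c + 1) % 3)
  cls-+m−2 = cls-⊕ (1 + 6 * p) 1 (2 * p) (solve (p ∷ []))

  cls-+m−1 : ∀ {i s c} → Class i s c → Class i (s + (2 + 6 * p)) ((c + 2) % 3)
  cls-+m−1 = cls-⊕ (2 + 6 * p) 2 (2 * p) (solve (p ∷ []))

  cls-+m : ∀ {i s c} → Class i s c → Class i (s + (3 + 6 * p)) ((c + 0) % 3)
  cls-+m = cls-⊕ (3 + 6 * p) 0 (1 + 2 * p) (solve (p ∷ []))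

  cls-+m+1 : ∀ {i s c} → Class i s c → Class i (s + (4 + 6 * p)) ((c + 1) % 3)
  cls-+m+1 = cls-⊕ (4 + 6 * p) 1 (1 + 2 * p) (solve (p ∷ []))

  cls-−1 : ∀ {i s c} → Class i s c → Class i (s + (5 + 12 * p)) ((c + 2) % 3)
  cls-−1 = cls-⊕ (5 + 12 * p) 2 (1 + 4 * p) (solve (p ∷ []))

  cls-rotate⁻¹1 : ∀ {i s c} → Class i s c → Class i (s + 1 * (5 + 12 * p)) ((c + 2) % 3)
  cls-rotate⁻¹1 = cls-⊕ (1 * (5 + 12 * p)) 2 (1 + 4 * p) (solve (p ∷ []))

  cls-+3w : ∀ i w → cls (i ⊕ (3 * w)) ≡ cls i
  cls-+3w i w = begin
    cls (i ⊕ (3 * w)) ≡⟨ cls-≡ (cls-⊕ (3 * w) 0 w (*-comm 3 w) (Class-base i)) ⟩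
    (cls i + 0) % 3   ≡⟨ cong (_% 3) (+-identityʳ (cls i)) ⟩
    cls i % 3         ≡⟨ m%n%n≡m%n (toℕ i) 3 ⟩
    cls i             ∎

  -- αA c i s is the image of A (i ⊕ s) when i + s ≡ c (mod 3); the offset s is carried along
  -- so that images of shifted vertices stay in the flat form A (i ⊕ k) or B (i ⊕ k).
  αA αB : ℕ → Fin (6 + 12 * p) → ℕ → V
  αA 0 i s = A (i ⊕ (s + (3 + 6 * p)))
  αA 1 i s = B (i ⊕ (s + 1))
  αA _ i s = B (i ⊕ (s + (4 + 6 * p)))
  αB 0 i s = A (i ⊕ (s + (2 + 6 * p)))
  αB 1 i s = B (i ⊕ (s + (3 + 6 * p)))
  αB _ i s = A (i ⊕ (s + (5 + 12 * p)))

  α : V → V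
  α (A i) = αA (cls i) i 0
  α (B i) = αB (cls i) i 0

  αA-⊕ : ∀ c i s → αA c (i ⊕ s) 0 ≡ αA c i s
  αA-⊕ 0             i s = cong A (⊕-assoc i s _)
  αA-⊕ 1             i s = cong B (⊕-assoc i s _)
  αA-⊕ (suc (suc _)) i s = cong B (⊕-assoc i s _)

  αB-⊕ : ∀ c i s → αB c (i ⊕ s) 0 ≡ αB c i s
  αB-⊕ 0             i s = cong A (⊕-assoc i s _)
  αB-⊕ 1             i s = cong B (⊕-assoc i s _)
  αB-⊕ (suc (suc _)) i s = cong A (⊕-assoc i s _)

  rotate-αA : ∀ c i s t → rotate t (αA c i s) ≡ αA c i (s + t)
  rotate-αA 0             i s t = cong A (⊕-slide i s _ t)
  rotate-αA 1             i s t = cong B (⊕-slide i s _ t)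
  rotate-αA (suc (suc _)) i s t = cong B (⊕-slide i s _ t)

  rotate-αB : ∀ c i s t → rotate t (αB c i s) ≡ αB c i (s + t)
  rotate-αB 0             i s t = cong A (⊕-slide i s _ t)
  rotate-αB 1             i s t = cong B (⊕-slide i s _ t)
  rotate-αB (suc (suc _)) i s t = cong A (⊕-slide i s _ t)

  α-A : ∀ {i s c} → Class i s c → α (A (i ⊕ s)) ≡ αA c i s
  α-A {i} {s} {c} (class e) = trans (cong (λ c → αA c (i ⊕ s) 0) e) (αA-⊕ c i s)

  α-B : ∀ {i s c} → Class i s c → α (B (i ⊕ s)) ≡ αB c i s
  α-B {i} {s} {c} (class e) = trans (cong (λ c → αB c (i ⊕ s) 0) e) (αB-⊕ c i s)

  α-A₀ : ∀ {i c} → Class i 0 c → α (A i) ≡ αA c i 0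
  α-A₀ {i} (class e) = cong (λ c → αA c i 0) (trans (cong cls (sym (⊕-identityʳ i))) e)

  α-B₀ : ∀ {i c} → Class i 0 c → α (B i) ≡ αB c i 0
  α-B₀ {i} (class e) = cong (λ c → αB c i 0) (trans (cong cls (sym (⊕-identityʳ i))) e)

  α-edge : ∀ {x y} → REdge (6 + 12 * p) (1 + 6 * p) (2 + 6 * p) x y → Adj (α x) (α y)
  α-edge (rim i) with residue i
  ... | res₀ c = Adj-≡ (α-A₀ c) (α-A (cls-+1 c))
        (spoke'-≈ i (3 + 6 * p) 2 0 0 (solve (p ∷ [])))
  ... | res₁ c = Adj-≡ (α-A₀ c) (α-A (cls-+1 c))
        (Adj-sym (hub-≈ i (5 + 6 * p) 1 0 1 (solve (p ∷ []))))
  ... | res₂ c = Adj-≡ (α-A₀ c) (α-A (cls-+1 c))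
        (Adj-sym (spoke-≈ i (4 + 6 * p) (4 + 6 * p) 0 0 refl))
  α-edge (spoke i) with residue i
  ... | res₀ c = Adj-≡ (α-A₀ c) (α-B₀ c)
        (Adj-sym (rim-≈ i (2 + 6 * p) (3 + 6 * p) 0 0 (solve (p ∷ []))))
  ... | res₁ c = Adj-≡ (α-A₀ c) (α-B₀ c)
        (hub-≈ i 1 (3 + 6 * p) 0 0 (solve (p ∷ [])))
  ... | res₂ c = Adj-≡ (α-A₀ c) (α-B₀ c)
        (Adj-sym (spoke'-≈ i (5 + 12 * p) (4 + 6 * p) 0 0 (solve (p ∷ []))))
  α-edge (spoke' i) with residue i
  ... | res₀ c = Adj-≡ (α-A (cls-+m−2 c)) (α-B₀ c)
        (Adj-sym (spoke-≈ i (2 + 6 * p) (1 + 6 * p + 1) 0 0 (solve (p ∷ []))))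
  ... | res₁ c = Adj-≡ (α-A (cls-+m−2 c)) (α-B₀ c)
        (Adj-sym (hub-≈ i (3 + 6 * p) (1 + 6 * p + (4 + 6 * p)) 0 0 (solve (p ∷ []))))
  ... | res₂ c = Adj-≡ (α-A (cls-+m−2 c)) (α-B₀ c)
        (rim-≈ i (1 + 6 * p + (3 + 6 * p)) (5 + 12 * p) 0 0 (solve (p ∷ [])))
  α-edge (hub i) with residue i
  ... | res₀ c = Adj-≡ (α-B₀ c) (α-B (cls-+m−1 c))
        (Adj-sym (rim-≈ i (2 + 6 * p + (5 + 12 * p)) (2 + 6 * p) 0 1 (solve (p ∷ []))))
  ... | res₁ c = Adj-≡ (α-B₀ c) (α-B (cls-+m−1 c))
        (Adj-sym (spoke'-≈ i (2 + 6 * p + (2 + 6 * p)) (3 + 6 * p) 0 0 (solve (p ∷ []))))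
  ... | res₂ c = Adj-≡ (α-B₀ c) (α-B (cls-+m−1 c))
        (spoke-≈ i (5 + 12 * p) (2 + 6 * p + (3 + 6 * p)) 0 0 (solve (p ∷ [])))

  α-adj : ∀ {x y} → Adj x y → Adj (α x) (α y)
  α-adj (inj₁ e) = α-edge e
  α-adj (inj₂ e) = Adj-sym (α-edge e)

  α-involutive : ∀ x → α (α x) ≡ x
  α-involutive (A i) with residue i
  ... | res₀ c = trans (cong α (α-A₀ c)) (trans (α-A (cls-+m c))
                   (cong A (⊕-period i (3 + 6 * p + (3 + 6 * p)) 1 (solve (p ∷ [])))))
  ... | res₁ c = trans (cong α (α-A₀ c)) (trans (α-B (cls-+1 c))
                   (cong A (⊕-period i (1 + (5 + 12 * p)) 1 (solve (p ∷ [])))))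
  ... | res₂ c = trans (cong α (α-A₀ c)) (trans (α-B (cls-+m+1 c))
                   (cong A (⊕-period i (4 + 6 * p + (2 + 6 * p)) 1 (solve (p ∷ [])))))
  α-involutive (B i) with residue i
  ... | res₀ c = trans (cong α (α-B₀ c)) (trans (α-A (cls-+m−1 c))
                   (cong B (⊕-period i (2 + 6 * p + (4 + 6 * p)) 1 (solve (p ∷ [])))))
  ... | res₁ c = trans (cong α (α-B₀ c)) (trans (α-B (cls-+m c))
                   (cong B (⊕-period i (3 + 6 * p + (3 + 6 * p)) 1 (solve (p ∷ [])))))
  ... | res₂ c = trans (cong α (α-B₀ c)) (trans (α-A (cls-−1 c))
                   (cong B (⊕-period i (5 + 12 * p + 1) 1 (solve (p ∷ [])))))

  αAut : Aut Γ
  αAut = record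
    { fun  = α
    ; inv  = α
    ; invˡ = α-involutive
    ; invʳ = α-involutive
    ; adj→ = λ _ _ → α-adj
    ; adj← = λ x y e → subst₂ Adj (α-involutive x) (α-involutive y) (α-adj e)
    }

  α-rotate-3* : ∀ w x → α (rotate (3 * w) x) ≡ rotate (3 * w) (α x)
  α-rotate-3* w (A i) = begin
    αA (cls (i ⊕ (3 * w))) (i ⊕ (3 * w)) 0 ≡⟨ cong (λ c → αA c (i ⊕ (3 * w)) 0) (cls-+3w i w) ⟩
    αA (cls i) (i ⊕ (3 * w)) 0             ≡⟨ αA-⊕ (cls i) i (3 * w) ⟩
    αA (cls i) i (3 * w)                   ≡⟨ rotate-αA (cls i) i 0 (3 * w) ⟨
    rotate (3 * w) (αA (cls i) i 0)        ∎
  α-rotate-3* w (B i) = begin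
    αB (cls (i ⊕ (3 * w))) (i ⊕ (3 * w)) 0 ≡⟨ cong (λ c → αB c (i ⊕ (3 * w)) 0) (cls-+3w i w) ⟩
    αB (cls i) (i ⊕ (3 * w)) 0             ≡⟨ αB-⊕ (cls i) i (3 * w) ⟩
    αB (cls i) i (3 * w)                   ≡⟨ rotate-αB (cls i) i 0 (3 * w) ⟨
    rotate (3 * w) (αB (cls i) i 0)        ∎

  β : ℕ → V → V
  β c x = rotate⁻¹ c (α (rotate c x))

  β-rotate : ∀ c t x → β c (rotate t x) ≡ rotate t (β (c + t) x)
  β-rotate c t x = begin
    rotate⁻¹ c (α (rotate c (rotate t x)))    ≡⟨ cong (rotate⁻¹ c ∘ α) (rotate-rotate t c x) ⟩
    rotate⁻¹ c (α (rotate (t + c) x))         ≡⟨ cong (λ k → rotate⁻¹ c (α (rotate k x))) (+-comm t c) ⟩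
    rotate (c * (5 + 12 * p)) y
      ≡⟨ rotate-≡ y (c * (5 + 12 * p)) ((c + t) * (5 + 12 * p) + t) t 0 (solve (c ∷ t ∷ p ∷ [])) ⟩
    rotate ((c + t) * (5 + 12 * p) + t) y     ≡⟨ rotate-rotate _ t y ⟨
    rotate t (rotate⁻¹ (c + t) y)             ∎
    where
    y = α (rotate (c + t) x)

  β-periodic : ∀ c w x → β (c + 3 * w) x ≡ β c x
  β-periodic c w x = begin
    rotate⁻¹ (c + 3 * w) (α (rotate (c + 3 * w) x))
      ≡⟨ cong (rotate⁻¹ (c + 3 * w) ∘ α) (rotate-rotate c (3 * w) x) ⟨
    rotate⁻¹ (c + 3 * w) (α (rotate (3 * w) (rotate c x)))
      ≡⟨ cong (rotate⁻¹ (c + 3 * w)) (α-rotate-3* w (rotate c x)) ⟩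
    rotate⁻¹ (c + 3 * w) (rotate (3 * w) y)
      ≡⟨ rotate-rotate (3 * w) _ y ⟩
    rotate (3 * w + (c + 3 * w) * (5 + 12 * p)) y
      ≡⟨ rotate-≡ y (3 * w + (c + 3 * w) * (5 + 12 * p)) (c * (5 + 12 * p)) 0 (3 * w) (solve (c ∷ w ∷ p ∷ [])) ⟩
    rotate⁻¹ c y
      ∎
    where
    y = α (rotate c x)

  β-involutive : ∀ c x → β c (β c x) ≡ x
  β-involutive c x = begin
    rotate⁻¹ c (α (rotate c (rotate⁻¹ c (α (rotate c x)))))
      ≡⟨ cong (rotate⁻¹ c ∘ α) (rotate-rotate⁻¹ c (α (rotate c x))) ⟩
    rotate⁻¹ c (α (α (rotate c x)))                         ≡⟨ cong (rotate⁻¹ c) (α-involutive _) ⟩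
    rotate⁻¹ c (rotate c x)                                 ≡⟨ rotate⁻¹-rotate c x ⟩
    x                                                       ∎

  α-β₁ : ∀ x → α (β 1 x) ≡ β 2 x
  α-β₁ (A i) with residue i
  ... | res₀ c = begin
    α (rotate⁻¹ 1 (α (A (i ⊕ 1))))                 ≡⟨ cong (α ∘ rotate⁻¹ 1) (α-A (cls-+1 c)) ⟩
    α (B ((i ⊕ 2) ⊕ (1 * (5 + 12 * p))))           ≡⟨ cong (α ∘ B) (⊕-assoc i 2 _) ⟩
    α (B (i ⊕ (2 + 1 * (5 + 12 * p))))             ≡⟨ α-B (cls-rotate⁻¹1 (cls-+1 (cls-+1 c))) ⟩
    B (i ⊕ (2 + 1 * (5 + 12 * p) + (3 + 6 * p)))
      ≡⟨ cong B (⊕-≡-⊕ i (2 + 1 * (5 + 12 * p) + (3 + 6 * p)) (6 + 6 * p) (2 * (5 + 12 * p)) 1 0 (solve (p ∷ []))) ⟩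
    B ((i ⊕ (6 + 6 * p)) ⊕ (2 * (5 + 12 * p)))     ≡⟨ cong (rotate⁻¹ 2) (α-A (cls-+2 c)) ⟨
    rotate⁻¹ 2 (α (A (i ⊕ 2)))                     ∎
  ... | res₁ c = begin
    α (rotate⁻¹ 1 (α (A (i ⊕ 1))))                 ≡⟨ cong (α ∘ rotate⁻¹ 1) (α-A (cls-+1 c)) ⟩
    α (B ((i ⊕ (5 + 6 * p)) ⊕ (1 * (5 + 12 * p)))) ≡⟨ cong (α ∘ B) (⊕-assoc i (5 + 6 * p) _) ⟩
    α (B (i ⊕ (5 + 6 * p + 1 * (5 + 12 * p))))     ≡⟨ α-B (cls-rotate⁻¹1 (cls-+m+1 (cls-+1 c))) ⟩
    A (i ⊕ (5 + 6 * p + 1 * (5 + 12 * p) + (5 + 12 * p)))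
      ≡⟨ cong A (⊕-≡-⊕ i (5 + 6 * p + 1 * (5 + 12 * p) + (5 + 12 * p)) (5 + 6 * p) (2 * (5 + 12 * p)) 0 0 (solve (p ∷ []))) ⟩
    A ((i ⊕ (5 + 6 * p)) ⊕ (2 * (5 + 12 * p)))     ≡⟨ cong (rotate⁻¹ 2) (α-A (cls-+2 c)) ⟨
    rotate⁻¹ 2 (α (A (i ⊕ 2)))                     ∎
  ... | res₂ c = begin
    α (rotate⁻¹ 1 (α (A (i ⊕ 1))))                 ≡⟨ cong (α ∘ rotate⁻¹ 1) (α-A (cls-+1 c)) ⟩
    α (A ((i ⊕ (4 + 6 * p)) ⊕ (1 * (5 + 12 * p)))) ≡⟨ cong (α ∘ A) (⊕-assoc i (4 + 6 * p) _) ⟩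
    α (A (i ⊕ (4 + 6 * p + 1 * (5 + 12 * p))))     ≡⟨ α-A (cls-rotate⁻¹1 (cls-+m (cls-+1 c))) ⟩
    B (i ⊕ (4 + 6 * p + 1 * (5 + 12 * p) + (4 + 6 * p)))
      ≡⟨ cong B (⊕-≡-⊕ i (4 + 6 * p + 1 * (5 + 12 * p) + (4 + 6 * p)) 3 (2 * (5 + 12 * p)) 0 0 (solve (p ∷ []))) ⟩
    B ((i ⊕ 3) ⊕ (2 * (5 + 12 * p)))               ≡⟨ cong (rotate⁻¹ 2) (α-A (cls-+2 c)) ⟨
    rotate⁻¹ 2 (α (A (i ⊕ 2)))                     ∎
  α-β₁ (B i) with residue i
  ... | res₀ c = begin
    α (rotate⁻¹ 1 (α (B (i ⊕ 1))))                 ≡⟨ cong (α ∘ rotate⁻¹ 1) (α-B (cls-+1 c)) ⟩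
    α (B ((i ⊕ (4 + 6 * p)) ⊕ (1 * (5 + 12 * p)))) ≡⟨ cong (α ∘ B) (⊕-assoc i (4 + 6 * p) _) ⟩
    α (B (i ⊕ (4 + 6 * p + 1 * (5 + 12 * p))))     ≡⟨ α-B (cls-rotate⁻¹1 (cls-+m (cls-+1 c))) ⟩
    A (i ⊕ (4 + 6 * p + 1 * (5 + 12 * p) + (2 + 6 * p)))
      ≡⟨ cong A (⊕-≡-⊕ i (4 + 6 * p + 1 * (5 + 12 * p) + (2 + 6 * p)) (7 + 12 * p) (2 * (5 + 12 * p)) 1 0 (solve (p ∷ []))) ⟩
    A ((i ⊕ (7 + 12 * p)) ⊕ (2 * (5 + 12 * p)))    ≡⟨ cong (rotate⁻¹ 2) (α-B (cls-+2 c)) ⟨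
    rotate⁻¹ 2 (α (B (i ⊕ 2)))                     ∎
  ... | res₁ c = begin
    α (rotate⁻¹ 1 (α (B (i ⊕ 1))))                 ≡⟨ cong (α ∘ rotate⁻¹ 1) (α-B (cls-+1 c)) ⟩
    α (A ((i ⊕ (6 + 12 * p)) ⊕ (1 * (5 + 12 * p)))) ≡⟨ cong (α ∘ A) (⊕-assoc i (6 + 12 * p) _) ⟩
    α (A (i ⊕ (6 + 12 * p + 1 * (5 + 12 * p))))    ≡⟨ α-A (cls-rotate⁻¹1 (cls-−1 (cls-+1 c))) ⟩
    A (i ⊕ (6 + 12 * p + 1 * (5 + 12 * p) + (3 + 6 * p)))
      ≡⟨ cong A (⊕-≡-⊕ i (6 + 12 * p + 1 * (5 + 12 * p) + (3 + 6 * p)) (4 + 6 * p) (2 * (5 + 12 * p)) 0 0 (solve (p ∷ []))) ⟩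
    A ((i ⊕ (4 + 6 * p)) ⊕ (2 * (5 + 12 * p)))     ≡⟨ cong (rotate⁻¹ 2) (α-B (cls-+2 c)) ⟨
    rotate⁻¹ 2 (α (B (i ⊕ 2)))                     ∎
  ... | res₂ c = begin
    α (rotate⁻¹ 1 (α (B (i ⊕ 1))))                 ≡⟨ cong (α ∘ rotate⁻¹ 1) (α-B (cls-+1 c)) ⟩
    α (A ((i ⊕ (3 + 6 * p)) ⊕ (1 * (5 + 12 * p)))) ≡⟨ cong (α ∘ A) (⊕-assoc i (3 + 6 * p) _) ⟩
    α (A (i ⊕ (3 + 6 * p + 1 * (5 + 12 * p))))     ≡⟨ α-A (cls-rotate⁻¹1 (cls-+m−1 (cls-+1 c))) ⟩
    B (i ⊕ (3 + 6 * p + 1 * (5 + 12 * p) + 1))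
      ≡⟨ cong B (⊕-≡-⊕ i (3 + 6 * p + 1 * (5 + 12 * p) + 1) (5 + 6 * p) (2 * (5 + 12 * p)) 1 0 (solve (p ∷ []))) ⟩
    B ((i ⊕ (5 + 6 * p)) ⊕ (2 * (5 + 12 * p)))     ≡⟨ cong (rotate⁻¹ 2) (α-B (cls-+2 c)) ⟨
    rotate⁻¹ 2 (α (B (i ⊕ 2)))                     ∎

  α-β₂ : ∀ x → α (β 2 x) ≡ β 1 x
  α-β₂ x = trans (cong α (sym (α-β₁ x))) (α-involutive (β 1 x))

  α-β₀ : ∀ x → α (β 0 x) ≡ x
  α-β₀ x = begin
    α (rotate 0 (α (rotate 0 x))) ≡⟨ cong α (rotate-zero (α (rotate 0 x))) ⟩
    α (α (rotate 0 x))            ≡⟨ α-involutive _ ⟩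
    rotate 0 x                    ≡⟨ rotate-zero x ⟩
    x                             ∎

  κ : Maybe ℕ → V → V
  κ nothing  x = x
  κ (just c) x = β c x

  κ-rotate : ∀ e t x → κ e (rotate t x) ≡ rotate t (κ (Maybe.map (_+ t) e) x)
  κ-rotate nothing  t x = refl
  κ-rotate (just c) t x = β-rotate c t x

  κ-conjugate : ∀ e t x → rotate⁻¹ t (κ e (rotate t x)) ≡ κ (Maybe.map (_+ t) e) x
  κ-conjugate e t x = trans (cong (rotate⁻¹ t) (κ-rotate e t x)) (rotate⁻¹-rotate t _)

  κ-periodic : ∀ e s t w → s + t ≡ 3 * w → ∀ x → κ (Maybe.map (_+ t) (Maybe.map (_+ s) e)) x ≡ κ e x
  κ-periodic nothing  s t w eq x = refl
  κ-periodic (just c) s t w eq x =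
    trans (cong (λ k → β k x) (trans (+-assoc c s t) (cong (c +_) eq))) (β-periodic c w x)

  κ-involutive : ∀ e x → κ e (κ e x) ≡ x
  κ-involutive nothing  x = refl
  κ-involutive (just c) x = β-involutive c x

  α∘β : ℕ → Maybe ℕ
  α∘β 0 = nothing
  α∘β 1 = just 2
  α∘β _ = just 1

  α-β : ∀ r → r < 3 → ∀ x → α (β r x) ≡ κ (α∘β r) x
  α-β 0 _ = α-β₀
  α-β 1 _ = α-β₁
  α-β 2 _ = α-β₂
  α-β (suc (suc (suc _))) (s≤s (s≤s (s≤s ())))

  infixl 7 _⋆_
  _⋆_ : Maybe ℕ → Maybe ℕ → Maybe ℕ
  nothing ⋆ e'      = e'
  just a  ⋆ nothing = just a
  just a  ⋆ just b  = Maybe.map (_+ a) (α∘β ((b + 2 * a) % 3))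

  -- β a β b = ρ^{−a} (α β_r) ρ^a for the residue r ≡ b − a (mod 3), i.e. r = (b + 2a) mod 3.
  β-β : ∀ a b x → β a (β b x) ≡ κ (just a ⋆ just b) x
  β-β a b x = begin
    β a (β b x)                         ≡⟨ cong (β a) (β-periodic b a x) ⟨
    β a (β (b + 3 * a) x)               ≡⟨ cong (λ k → β a (β k x)) b+3a≡ ⟩
    β a (β (a + r + 3 * w) x)           ≡⟨ cong (β a) (β-periodic (a + r) w x) ⟩
    β a (β (a + r) x)
      ≡⟨ cong (rotate⁻¹ a ∘ α) (trans (cong (λ k → rotate a (β k x)) (+-comm a r)) (sym (β-rotate r a x))) ⟩
    rotate⁻¹ a (α (β r (rotate a x)))   ≡⟨ cong (rotate⁻¹ a) (α-β r (m%n<n (b + 2 * a) 3) (rotate a x)) ⟩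
    rotate⁻¹ a (κ (α∘β r) (rotate a x)) ≡⟨ κ-conjugate (α∘β r) a x ⟩
    κ (Maybe.map (_+ a) (α∘β r)) x      ∎
    where
    r = (b + 2 * a) % 3
    w = (b + 2 * a) / 3
    b+3a≡ : b + 3 * a ≡ a + r + 3 * w
    b+3a≡ = begin
      b + 3 * a       ≡⟨ solve (a ∷ b ∷ []) ⟩
      a + (b + 2 * a) ≡⟨ cong (a +_) (m≡m%n+[m/n]*n (b + 2 * a) 3) ⟩
      a + (r + w * 3) ≡⟨ +-assoc a r (w * 3) ⟨
      a + r + w * 3   ≡⟨ cong (a + r +_) (*-comm w 3) ⟩
      a + r + 3 * w   ∎

  κ-⋆ : ∀ e e' x → κ e (κ e' x) ≡ κ (e ⋆ e') x
  κ-⋆ nothing  e'       x = refl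
  κ-⋆ (just a) nothing  x = refl
  κ-⋆ (just a) (just b) x = β-β a b x

  -- The subgroup H = ⟨ρ²⟩ K

  act : ℕ → Maybe ℕ → V → V
  act j e x = rotate (2 * j) (κ e x)

  rotate-2* : ∀ j j' (x : V) → rotate (2 * j) (rotate (2 * j') x) ≡ rotate (2 * (j + j')) x
  rotate-2* j j' x = trans (rotate-rotate (2 * j') (2 * j) x)
    (cong (λ k → rotate k x) (trans (+-comm (2 * j') (2 * j)) (sym (*-distribˡ-+ 2 j j'))))

  act-∘ : ∀ j e j' e' x → act j e (act j' e' x) ≡ act (j + j') (Maybe.map (_+ 2 * j') e ⋆ e') x
  act-∘ j e j' e' x = begin
    rotate (2 * j) (κ e (rotate (2 * j') (κ e' x)))
      ≡⟨ cong (rotate (2 * j)) (κ-rotate e (2 * j') _) ⟩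
    rotate (2 * j) (rotate (2 * j') (κ e₂ⱼ′ (κ e' x)))
      ≡⟨ cong (rotate (2 * j) ∘ rotate (2 * j')) (κ-⋆ e₂ⱼ′ e' x) ⟩
    rotate (2 * j) (rotate (2 * j') (κ (e₂ⱼ′ ⋆ e') x))
      ≡⟨ rotate-2* j j' _ ⟩
    rotate (2 * (j + j')) (κ (e₂ⱼ′ ⋆ e') x)
      ∎
    where
    e₂ⱼ′ = Maybe.map (_+ 2 * j') e

  -- k = j (2 + 6p) satisfies 2k ≡ −2j (mod 6 + 12p).
  act-inverse : ∀ j e → Σ ℕ λ k → Σ (Maybe ℕ) λ e⁻ →
                (∀ x → act j e (act k e⁻ x) ≡ x) × (∀ x → act k e⁻ (act j e x) ≡ x)
  act-inverse j e = k , e⁻ , right , left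
    where
    k = j * (2 + 6 * p)
    e⁻ = Maybe.map (_+ 2 * k) e

    2j+2k≡0 : ∀ x → rotate (2 * j) (rotate (2 * k) x) ≡ x
    2j+2k≡0 x = trans (rotate-2* j k x) (rotate-period x (2 * (j + j * (2 + 6 * p))) j (solve (j ∷ p ∷ [])))

    2k+2j≡0 : ∀ x → rotate (2 * k) (rotate (2 * j) x) ≡ x
    2k+2j≡0 x = trans (rotate-2* k j x) (rotate-period x (2 * (j * (2 + 6 * p) + j)) j (solve (j ∷ p ∷ [])))

    right : ∀ x → act j e (act k e⁻ x) ≡ x
    right x = begin
      rotate (2 * j) (κ e (rotate (2 * k) (κ e⁻ x)))  ≡⟨ cong (rotate (2 * j)) (κ-rotate e (2 * k) _) ⟩
      rotate (2 * j) (rotate (2 * k) (κ e⁻ (κ e⁻ x))) ≡⟨ cong (rotate (2 * j) ∘ rotate (2 * k)) (κ-involutive e⁻ x) ⟩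
      rotate (2 * j) (rotate (2 * k) x)               ≡⟨ 2j+2k≡0 x ⟩
      x                                               ∎

    left : ∀ x → act k e⁻ (act j e x) ≡ x
    left x = begin
      rotate (2 * k) (κ e⁻ (rotate (2 * j) (κ e x)))
        ≡⟨ cong (rotate (2 * k)) (κ-rotate e⁻ (2 * j) _) ⟩
      rotate (2 * k) (rotate (2 * j) (κ (Maybe.map (_+ 2 * j) e⁻) (κ e x)))
        ≡⟨ cong (rotate (2 * k) ∘ rotate (2 * j))
                (κ-periodic e (2 * (j * (2 + 6 * p))) (2 * j) (j * (2 + 4 * p)) (solve (j ∷ p ∷ [])) _) ⟩
      rotate (2 * k) (rotate (2 * j) (κ e (κ e x)))
        ≡⟨ cong (rotate (2 * k) ∘ rotate (2 * j)) (κ-involutive e x) ⟩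
      rotate (2 * k) (rotate (2 * j) x)
        ≡⟨ 2k+2j≡0 x ⟩
      x ∎

  2∣n : 2 ∣ 6 + 12 * p
  2∣n = divides (3 + 6 * p) (solve (p ∷ []))

  2∤m+2t : ∀ t → ¬ 2 ∣ 3 + 6 * p + 2 * t
  2∤m+2t t 2∣ with ∣1⇒≡1 (∣m+n∣m⇒∣n (subst (2 ∣_) odd 2∣) (n∣m*n (1 + 3 * p + t)))
    where
    odd : 3 + 6 * p + 2 * t ≡ (1 + 3 * p + t) * 2 + 1
    odd = solve (p ∷ t ∷ [])
  ... | ()

  half-turn-unfixed : ∀ i t → (i ⊕ (3 + 6 * p)) ⊕ (2 * t) ≢ i
  half-turn-unfixed i t fix = 2∤m+2t t (∣-trans 2∣n (⊕-fixed⇒∣ (trans (sym (⊕-assoc i _ _)) fix)))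

  A≢B : ∀ {i j : Fin (6 + 12 * p)} → A i ≢ B j
  A≢B ()

  α-unfixed : ∀ t z → rotate (2 * t) (α z) ≢ z
  α-unfixed t (A i) fix with residue i
  ... | res₀ c = half-turn-unfixed i t (cong index (trans (cong (rotate (2 * t)) (sym (α-A₀ c))) fix))
  ... | res₁ c = A≢B (sym (trans (cong (rotate (2 * t)) (sym (α-A₀ c))) fix))
  ... | res₂ c = A≢B (sym (trans (cong (rotate (2 * t)) (sym (α-A₀ c))) fix))
  α-unfixed t (B i) fix with residue i
  ... | res₀ c = A≢B (trans (cong (rotate (2 * t)) (sym (α-B₀ c))) fix)
  ... | res₁ c = half-turn-unfixed i t (cong index (trans (cong (rotate (2 * t)) (sym (α-B₀ c))) fix))
  ... | res₂ c = A≢B (trans (cong (rotate (2 * t)) (sym (α-B₀ c))) fix)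

  rotate-conjugate : ∀ c s (z : V) → rotate c (rotate s (rotate⁻¹ c z)) ≡ rotate s z
  rotate-conjugate c s z = begin
    rotate c (rotate s (rotate⁻¹ c z))         ≡⟨ cong (rotate c) (rotate-rotate _ s z) ⟩
    rotate c (rotate (c * (5 + 12 * p) + s) z) ≡⟨ rotate-rotate _ c z ⟩
    rotate (c * (5 + 12 * p) + s + c) z        ≡⟨ rotate-≡ z (c * (5 + 12 * p) + s + c) s 0 c (solve (c ∷ s ∷ p ∷ [])) ⟩
    rotate s z                                 ∎

  act-fixed : ∀ j e x → act j e x ≡ x → ∀ y → act j e y ≡ y
  act-fixed j nothing  x fix = rotate-multiple (rotate-fixed⇒∣ x fix)
  act-fixed j (just c) x fix =
    ⊥-elim (α-unfixed j (rotate c x) (trans (sym (rotate-conjugate c (2 * j) _)) (cong (rotate c) fix)))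

  act-free : ∀ j e j' e' x → act j e x ≡ act j' e' x → ∀ y → act j e y ≡ act j' e' y
  act-free j e j' e' x eq y =
    let (k , e⁻ , right , left) = act-inverse j' e'
        F = Maybe.map (_+ 2 * j) e⁻ ⋆ e
        fixes : act (k + j) F x ≡ x
        fixes = trans (sym (act-∘ k e⁻ j e x)) (trans (cong (act k e⁻) eq) (left x))
    in begin
    act j e y                       ≡⟨ right (act j e y) ⟨
    act j' e' (act k e⁻ (act j e y)) ≡⟨ cong (act j' e') (act-∘ k e⁻ j e y) ⟩
    act j' e' (act (k + j) F y)     ≡⟨ cong (act j' e') (act-fixed (k + j) F x fixes y) ⟩
    act j' e' y                     ∎

  zero-⊕³ : ∀ i s₁ s₂ s₃ v → s₁ + s₂ + s₃ ≡ toℕ i + v * (6 + 12 * p) →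
            ((fzero ⊕ s₁) ⊕ s₂) ⊕ s₃ ≡ i
  zero-⊕³ i s₁ s₂ s₃ v eq = begin
    ((fzero ⊕ s₁) ⊕ s₂) ⊕ s₃ ≡⟨ cong (_⊕ s₃) (⊕-assoc fzero s₁ s₂) ⟩
    (fzero ⊕ (s₁ + s₂)) ⊕ s₃ ≡⟨ ⊕-assoc fzero (s₁ + s₂) s₃ ⟩
    fzero ⊕ (s₁ + s₂ + s₃)   ≡⟨ zero-⊕ i _ 0 v (trans (+-identityʳ _) eq) ⟩
    i                        ∎

  -- ρ^{2j}, ρ^{2j} β₀, ρ^{2j} β₁, ρ^{2j} β₂ send A₀ to A_{2j}, A_{2j+m}, B_{2j+1}, B_{2j+m+1}.
  act-origin : ∀ y → Σ ℕ λ j → Σ (Maybe ℕ) λ e → act j e (A fzero) ≡ y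
  act-origin (A i) with toℕ i divMod 2
  ... | result s fzero eq = s , nothing , cong A (zero-⊕ i (2 * s) 0 0 (begin
    2 * s + 0 * (6 + 12 * p) ≡⟨ solve (s ∷ p ∷ []) ⟩
    s * 2 + 0 * (6 + 12 * p) ≡⟨ cong (_+ 0 * (6 + 12 * p)) eq ⟨
    toℕ i + 0 * (6 + 12 * p) ∎))
  ... | result s (fsuc fzero) eq = s + 2 + 3 * p , just 0 , (begin
    act (s + 2 + 3 * p) (just 0) (A fzero)
      ≡⟨ cong (rotate (2 * (s + 2 + 3 * p)) ∘ rotate 0) (α-A {fzero} {0} (class refl)) ⟩
    A (((fzero ⊕ (3 + 6 * p)) ⊕ 0) ⊕ (2 * (s + 2 + 3 * p)))
      ≡⟨ cong A (zero-⊕³ i (3 + 6 * p) 0 (2 * (s + 2 + 3 * p)) 1 (begin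
        3 + 6 * p + 0 + 2 * (s + 2 + 3 * p) ≡⟨ solve (s ∷ p ∷ []) ⟩
        1 + s * 2 + 1 * (6 + 12 * p)        ≡⟨ cong (_+ 1 * (6 + 12 * p)) eq ⟨
        toℕ i + 1 * (6 + 12 * p)            ∎)) ⟩
    A i ∎)
  act-origin (B i) with toℕ i divMod 2
  ... | result s fzero eq = s + 1 + 3 * p , just 2 , (begin
    act (s + 1 + 3 * p) (just 2) (A fzero)
      ≡⟨ cong (rotate (2 * (s + 1 + 3 * p)) ∘ rotate (2 * (5 + 12 * p))) (α-A {fzero} {2} (class refl)) ⟩
    B (((fzero ⊕ (6 + 6 * p)) ⊕ (2 * (5 + 12 * p))) ⊕ (2 * (s + 1 + 3 * p)))
      ≡⟨ cong B (zero-⊕³ i (6 + 6 * p) (2 * (5 + 12 * p)) (2 * (s + 1 + 3 * p)) 3 (begin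
        6 + 6 * p + 2 * (5 + 12 * p) + 2 * (s + 1 + 3 * p) ≡⟨ solve (s ∷ p ∷ []) ⟩
        s * 2 + 3 * (6 + 12 * p)                           ≡⟨ cong (_+ 3 * (6 + 12 * p)) eq ⟨
        toℕ i + 3 * (6 + 12 * p)                           ∎)) ⟩
    B i ∎)
  ... | result s (fsuc fzero) eq = s , just 1 , (begin
    act s (just 1) (A fzero)
      ≡⟨ cong (rotate (2 * s) ∘ rotate (1 * (5 + 12 * p))) (α-A {fzero} {1} (class refl)) ⟩
    B (((fzero ⊕ 2) ⊕ (1 * (5 + 12 * p))) ⊕ (2 * s))
      ≡⟨ cong B (zero-⊕³ i 2 (1 * (5 + 12 * p)) (2 * s) 1 (begin
        2 + 1 * (5 + 12 * p) + 2 * s ≡⟨ solve (s ∷ p ∷ []) ⟩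
        1 + s * 2 + 1 * (6 + 12 * p) ≡⟨ cong (_+ 1 * (6 + 12 * p)) eq ⟨
        toℕ i + 1 * (6 + 12 * p)     ∎)) ⟩
    B i ∎)

  act-transitive : ∀ x y → Σ ℕ λ j → Σ (Maybe ℕ) λ e → act j e x ≡ y
  act-transitive x y =
    let (jx , ex , x≡) = act-origin x
        (jy , ey , y≡) = act-origin y
        (k , e⁻ , _ , left) = act-inverse jx ex
    in jy + k , Maybe.map (_+ 2 * k) ey ⋆ e⁻ , (begin
    act (jy + k) (Maybe.map (_+ 2 * k) ey ⋆ e⁻) x ≡⟨ act-∘ jy ey k e⁻ x ⟨
    act jy ey (act k e⁻ x)                     ≡⟨ cong (act jy ey ∘ act k e⁻) x≡ ⟨
    act jy ey (act k e⁻ (act jx ex (A fzero))) ≡⟨ cong (act jy ey) (left (A fzero)) ⟩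
    act jy ey (A fzero)                        ≡⟨ y≡ ⟩
    y                                          ∎)

  κAut : Maybe ℕ → Aut Γ
  κAut nothing  = idAut
  κAut (just c) = rotation (c * (5 + 12 * p)) ∘A (αAut ∘A rotation c)

  actAut : ℕ → Maybe ℕ → Aut Γ
  actAut j e = rotation (2 * j) ∘A κAut e

  actAut-fun : ∀ j e x → Aut.fun (actAut j e) x ≡ act j e x
  actAut-fun j nothing  x = refl
  actAut-fun j (just c) x = refl

  InH : Aut Γ → Set
  InH f = Σ ℕ λ j → Σ (Maybe ℕ) λ e → ∀ x → Aut.fun f x ≡ act j e x

  H-subgroup : IsSubgroup InH
  H-subgroup = record
    { resp       = λ f≐g (j , e , f≡) → j , e , λ x → trans (sym (f≐g x)) (f≡ x)
    ; hasId      = 0 , nothing , λ x → sym (rotate-zero x)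
    ; ∘-closed   = λ (j , e , f≡) (j' , e' , g≡) →
        j + j' , Maybe.map (_+ 2 * j') e ⋆ e' , λ x → trans (f≡ _) (trans (cong (act j e) (g≡ x)) (act-∘ j e j' e' x))
    ; inv-closed = λ {f} (j , e , f≡) →
        let (k , e⁻ , right , _) = act-inverse j e in
        k , e⁻ , λ x → trans (cong (Aut.inv f) (sym (trans (f≡ _) (right x)))) (Aut.invˡ f _)
    }

  H-regular : ActsRegularly InH
  H-regular = record
    { transitive = λ x y →
        let (j , e , eq) = act-transitive x y in
        actAut j e , (j , e , actAut-fun j e) , trans (actAut-fun j e x) eq
    ; free = λ x (j , e , g≡) (j' , e' , h≡) gx≡hx y →
        trans (g≡ y) (trans (act-free j e j' e' x (trans (sym (g≡ x)) (trans gx≡hx (h≡ x))) y) (sym (h≡ y)))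
    }

  cayley : IsCayley Γ
  cayley = InH , H-subgroup , H-regular

odd-multiple-of-3 : ∀ {m} → 3 ∣ m → ¬ 2 ∣ m → Σ ℕ λ p → m ≡ 3 + 6 * p
odd-multiple-of-3 (divides k refl) 2∤m with k divMod 2
... | result s fzero        refl = ⊥-elim (2∤m (divides (s * 3) (solve (s ∷ []))))
... | result s (fsuc fzero) refl = s , solve (s ∷ [])

mainTheorem9 : ∀ (m : ℕ) → 3 ∣ m → ¬ (2 ∣ m)
             → IsCayley (Rose (2 * m) (m ∸ 2) (m ∸ 1))
mainTheorem9 m 3∣m 2∤m with odd-multiple-of-3 3∣m 2∤m
... | p , refl = subst (λ n → IsCayley (Rose n (1 + 6 * p) (2 + 6 * p))) n≡2m (Rose₂ₘ.cayley p)
  where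
  n≡2m : 6 + 12 * p ≡ 2 * (3 + 6 * p)
  n≡2m = solve (p ∷ [])
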